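{- Let $(S_n)_{n\ge0}$ be defined by $S_0=3$, $S_1=1$, $S_2=3$ and $S_{n+1}=S_n+S_{n-1}+S_{n-2}$ for $n\ge2$. Let $\alpha,\beta,\gamma$ be the roots of $x^3-x^2-x-1=0$ and $C_n=\alpha^n\beta^n+\alpha^n\gamma^n+\beta^n\gamma^n$ for $n\ge0$. Then for all integers $n\ge0$, $$S_n^4=S_{4n}+2C_{2n}+4C_n^2+4S_{2n}C_n \quad\text{and}\quad S_n^4=S_{4n}-4S_n+4S_{2n}C_n+6C_n^2.$$
   Context: $S_n=\alpha^n+\beta^n+\gamma^n$. -}

module Defs where

open import Data.Nat using (ℕ; zero; suc)
import Data.Nat as ℕ
open import Algebra.Bundles using (CommutativeRing)

S : ℕ → ℕ
S 0 = 3
S 1 = 1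
S 2 = 3
S (suc (suc (suc n))) = S (suc (suc n)) ℕ.+ S (suc n) ℕ.+ S n

module InRing {c ℓ} (R : CommutativeRing c ℓ) where
  open CommutativeRing R

  infixr 8 _^_
  _^_ : Carrier → ℕ → Carrier
  x ^ zero  = 1#
  x ^ suc n = x * (x ^ n)

  ι : ℕ → Carrier
  ι zero    = 0#
  ι (suc n) = 1# + ι n

  -- α, β, γ are the three roots (with multiplicity) of x³ - x² - x - 1,
  -- i.e. (x - α)(x - β)(x - γ) = x³ - x² - x - 1 coefficientwise (Vieta).
  record RootsOfCubic (α β γ : Carrier) : Set ℓ where
    field
      e₁ : α + β + γ ≈ 1#
      e₂ : α * β + α * γ + β * γ ≈ - 1#
      e₃ : α * β * γ ≈ 1#

  C : Carrier → Carrier → Carrier → ℕ → Carrier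
  C α β γ n = (α ^ n) * (β ^ n) + (α ^ n) * (γ ^ n) + (β ^ n) * (γ ^ n)

{-# OPTIONS --safe #-}
module Submission where

-- With x = αⁿ, y = βⁿ, z = γⁿ, the numbers S_n, S_2n, S_4n are the power sums
-- x^k + y^k + z^k (k = 1, 2, 4), C_n is the second elementary symmetric function
-- σ₂ of x, y, z, and σ₃ = (αβγ)ⁿ = 1.  Both identities are then expansions of
-- (x + y + z)⁴ in power sums and elementary symmetric functions.  That S_n is the
-- n-th power sum of α, β, γ follows from α³ = α² + α + 1 (for each root) and
-- Newton's identity p₂ = σ₁² - 2σ₂ for the initial values.

open import Defs
open import Data.Nat using (ℕ; zero; suc)
import Data.Nat as ℕ
import Data.Nat.Properties as ℕ
open import Data.Product using (_×_; _,_)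
open import Algebra.Bundles using (CommutativeRing)
import Relation.Binary.PropositionalEquality as ≡

module _ {c ℓ} (R : CommutativeRing c ℓ) where
  open CommutativeRing R
  open InRing R
  open import Relation.Binary.Reasoning.Setoid setoid
  import Algebra.Properties.CommutativeSemiring.Exp commutativeSemiring as Exp
  import Algebra.Properties.Monoid.Mult +-monoid as Mult
  open import Algebra.Properties.Group +-group using (//-rightDividesʳ)
  open import Algebra.Solver.Ring.NaturalCoefficients.Default commutativeSemiring
    using (solve; _:=_; _:+_; _:*_; _:^_; con; Polynomial)

  ^≡Exp^ : ∀ x n → x ^ n ≡.≡ x Exp.^ n
  ^≡Exp^ x zero    = ≡.refl
  ^≡Exp^ x (suc n) = ≡.cong (x *_) (^≡Exp^ x n)

  ι≡×1# : ∀ n → ι n ≡.≡ n Mult.× 1#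
  ι≡×1# zero    = ≡.refl
  ι≡×1# (suc n) = ≡.cong (1# +_) (ι≡×1# n)

  ι-homo-+ : ∀ m n → ι (m ℕ.+ n) ≈ ι m + ι n
  ι-homo-+ m n rewrite ι≡×1# (m ℕ.+ n) | ι≡×1# m | ι≡×1# n = Mult.×-homo-+ 1# m n

  ^-congˡ : ∀ {x y} n → x ≈ y → x ^ n ≈ y ^ n
  ^-congˡ {x} {y} n x≈y rewrite ^≡Exp^ x n | ^≡Exp^ y n = Exp.^-congˡ n x≈y

  ^-*-comm : ∀ x m n → x ^ (m ℕ.* n) ≈ (x ^ n) ^ m
  ^-*-comm x m n rewrite ^≡Exp^ x (m ℕ.* n) | ^≡Exp^ x n | ^≡Exp^ (x Exp.^ n) m | ℕ.*-comm m n =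
    sym (Exp.^-assocʳ x n m)

  ^-distrib-* : ∀ x y n → (x * y) ^ n ≈ x ^ n * y ^ n
  ^-distrib-* x y n rewrite ^≡Exp^ (x * y) n | ^≡Exp^ x n | ^≡Exp^ y n = Exp.^-distrib-* x y n

  1#^n≈1# : ∀ n → 1# ^ n ≈ 1#
  1#^n≈1# zero    = refl
  1#^n≈1# (suc n) = trans (*-identityˡ _) (1#^n≈1# n)

  x+y≈z⇒x≈z-y : ∀ {x y z} → x + y ≈ z → x ≈ z - y
  x+y≈z⇒x≈z-y {x} {y} x+y≈z = trans (sym (//-rightDividesʳ y x)) (+-congʳ x+y≈z)

  x+y+z-w≈x-w+y+z : ∀ x y z w → x + y + z - w ≈ x - w + y + z
  x+y+z-w≈x-w+y+z x y z w =
    solve 4 (λ x y z w → x :+ y :+ z :+ w := x :+ w :+ y :+ z) refl x y z (- w)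

  z≈0⇒x≈x+y*z : ∀ x y {z} → z ≈ 0# → x ≈ x + y * z
  z≈0⇒x≈x+y*z x y {z} z≈0 = begin
    x          ≈⟨ +-identityʳ x ⟨
    x + 0#     ≈⟨ +-congˡ (zeroʳ y) ⟨
    x + y * 0# ≈⟨ +-congˡ (*-congˡ z≈0) ⟨
    x + y * z  ∎

  σ₁ σ₂ σ₃ : Carrier → Carrier → Carrier → Carrier
  σ₁ x y z = x + y + z
  σ₂ x y z = x * y + x * z + y * z
  σ₃ x y z = x * y * z

  powerSum : Carrier → Carrier → Carrier → ℕ → Carrier
  powerSum x y z k = x ^ k + y ^ k + z ^ k

  -- ⟦ con k ⟧ is the library's k × 1#, which is not definitionally ι k;
  -- ⟦ ιₚ k ⟧ reduces to ι k itself.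
  ιₚ : ∀ {m} → ℕ → Polynomial m
  ιₚ zero    = con 0
  ιₚ (suc k) = con 1 :+ ιₚ k

  x³+σ₂x≈σ₁x²+σ₃ : ∀ x y z → x ^ 3 + σ₂ x y z * x ≈ σ₁ x y z * x ^ 2 + σ₃ x y z
  x³+σ₂x≈σ₁x²+σ₃ = solve 3 (λ x y z →
    x :^ 3 :+ (x :* y :+ x :* z :+ y :* z) :* x := (x :+ y :+ z) :* x :^ 2 :+ x :* y :* z) refl

  newton₂ : ∀ x y z → powerSum x y z 2 + ι 2 * σ₂ x y z ≈ σ₁ x y z ^ 2
  newton₂ = solve 3 (λ x y z →
    x :^ 2 :+ y :^ 2 :+ z :^ 2 :+ ιₚ 2 :* (x :* y :+ x :* z :+ y :* z) := (x :+ y :+ z) :^ 2) refl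

  σ₁⁴-expansion : ∀ x y z →
    σ₁ x y z ^ 4 ≈ powerSum x y z 4 + ι 2 * σ₂ (x ^ 2) (y ^ 2) (z ^ 2)
                   + ι 4 * σ₂ x y z ^ 2 + ι 4 * (powerSum x y z 2 * σ₂ x y z)
  σ₁⁴-expansion = solve 3 (λ x y z →
    (x :+ y :+ z) :^ 4
      := x :^ 4 :+ y :^ 4 :+ z :^ 4
         :+ ιₚ 2 :* (x :^ 2 :* y :^ 2 :+ x :^ 2 :* z :^ 2 :+ y :^ 2 :* z :^ 2)
         :+ ιₚ 4 :* (x :* y :+ x :* z :+ y :* z) :^ 2
         :+ ιₚ 4 :* ((x :^ 2 :+ y :^ 2 :+ z :^ 2) :* (x :* y :+ x :* z :+ y :* z))) refl

  σ₁⁴+4σ₁σ₃-expansion : ∀ x y z →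
    σ₁ x y z ^ 4 + ι 4 * (σ₁ x y z * σ₃ x y z)
      ≈ powerSum x y z 4 + ι 4 * (powerSum x y z 2 * σ₂ x y z) + ι 6 * σ₂ x y z ^ 2
  σ₁⁴+4σ₁σ₃-expansion = solve 3 (λ x y z →
    (x :+ y :+ z) :^ 4 :+ ιₚ 4 :* ((x :+ y :+ z) :* (x :* y :* z))
      := x :^ 4 :+ y :^ 4 :+ z :^ 4
         :+ ιₚ 4 :* ((x :^ 2 :+ y :^ 2 :+ z :^ 2) :* (x :* y :+ x :* z :+ y :* z))
         :+ ιₚ 6 :* (x :* y :+ x :* z :+ y :* z) :^ 2) refl

  σ₁-rotate : ∀ x y z → σ₁ y z x ≈ σ₁ x y z
  σ₁-rotate = solve 3 (λ x y z → y :+ z :+ x := x :+ y :+ z) refl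

  σ₂-rotate : ∀ x y z → σ₂ y z x ≈ σ₂ x y z
  σ₂-rotate = solve 3 (λ x y z → y :* z :+ y :* x :+ z :* x := x :* y :+ x :* z :+ y :* z) refl

  σ₃-rotate : ∀ x y z → σ₃ y z x ≈ σ₃ x y z
  σ₃-rotate = solve 3 (λ x y z → y :* z :* x := x :* y :* z) refl

  powerSum-* : ∀ x y z k n → powerSum x y z (k ℕ.* n) ≈ powerSum (x ^ n) (y ^ n) (z ^ n) k
  powerSum-* x y z k n = +-cong (+-cong (^-*-comm x k n) (^-*-comm y k n)) (^-*-comm z k n)

  C-* : ∀ x y z k n → C x y z (k ℕ.* n) ≈ σ₂ ((x ^ n) ^ k) ((y ^ n) ^ k) ((z ^ n) ^ k)
  C-* x y z k n = +-cong (+-cong (*-cong xᵏⁿ yᵏⁿ) (*-cong xᵏⁿ zᵏⁿ)) (*-cong yᵏⁿ zᵏⁿ)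
    where
    xᵏⁿ = ^-*-comm x k n
    yᵏⁿ = ^-*-comm y k n
    zᵏⁿ = ^-*-comm z k n

  σ₃-^ : ∀ x y z n → σ₃ (x ^ n) (y ^ n) (z ^ n) ≈ σ₃ x y z ^ n
  σ₃-^ x y z n = sym (trans (^-distrib-* (x * y) z n) (*-congʳ (^-distrib-* x y n)))

  ^-recurrence : ∀ {x} → x ^ 3 ≈ x ^ 2 + x + 1# → ∀ n →
                 x ^ (3 ℕ.+ n) ≈ x ^ (2 ℕ.+ n) + x ^ (1 ℕ.+ n) + x ^ n
  ^-recurrence {x} x³≈x²+x+1 n = begin
    x ^ (3 ℕ.+ n)
      ≈⟨ solve 2 (λ x y → x :* (x :* (x :* y)) := x :^ 3 :* y) refl x (x ^ n) ⟩
    x ^ 3 * x ^ n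
      ≈⟨ *-congʳ x³≈x²+x+1 ⟩
    (x ^ 2 + x + 1#) * x ^ n
      ≈⟨ solve 2 (λ x y → (x :^ 2 :+ x :+ con 1) :* y := x :* (x :* y) :+ x :* y :+ y) refl x (x ^ n) ⟩
    x ^ (2 ℕ.+ n) + x ^ (1 ℕ.+ n) + x ^ n ∎

  σ₂+1≈0 : ∀ {α β γ} → RootsOfCubic α β γ → σ₂ α β γ + 1# ≈ 0#
  σ₂+1≈0 roots = trans (+-congʳ (RootsOfCubic.e₂ roots)) (-‿inverseˡ 1#)

  RootsOfCubic-rotate : ∀ {α β γ} → RootsOfCubic α β γ → RootsOfCubic β γ α
  RootsOfCubic-rotate {α} {β} {γ} roots = record
    { e₁ = trans (σ₁-rotate α β γ) e₁
    ; e₂ = trans (σ₂-rotate α β γ) e₂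
    ; e₃ = trans (σ₃-rotate α β γ) e₃
    }
    where open RootsOfCubic roots

  α³≈α²+α+1 : ∀ {α β γ} → RootsOfCubic α β γ → α ^ 3 ≈ α ^ 2 + α + 1#
  α³≈α²+α+1 {α} {β} {γ} roots = begin
    α ^ 3                                ≈⟨ z≈0⇒x≈x+y*z (α ^ 3) α (σ₂+1≈0 roots) ⟩
    α ^ 3 + α * (σ₂ α β γ + 1#)          ≈⟨ solve 2 (λ x s → x :^ 3 :+ x :* (s :+ con 1)
                                                    := x :^ 3 :+ s :* x :+ x) refl α (σ₂ α β γ) ⟩
    α ^ 3 + σ₂ α β γ * α + α             ≈⟨ +-congʳ (x³+σ₂x≈σ₁x²+σ₃ α β γ) ⟩
    σ₁ α β γ * α ^ 2 + σ₃ α β γ + α      ≈⟨ +-congʳ (+-cong (*-congʳ e₁) e₃) ⟩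
    1# * α ^ 2 + 1# + α                  ≈⟨ solve 1 (λ x → con 1 :* x :^ 2 :+ con 1 :+ x
                                                    := x :^ 2 :+ x :+ con 1) refl α ⟩
    α ^ 2 + α + 1#                       ∎
    where open RootsOfCubic roots

  module _ {α β γ : Carrier} (roots : RootsOfCubic α β γ) where
    open RootsOfCubic roots

    powerSum-recurrence : ∀ n → powerSum α β γ (3 ℕ.+ n)
                                ≈ powerSum α β γ (2 ℕ.+ n) + powerSum α β γ (1 ℕ.+ n) + powerSum α β γ n
    powerSum-recurrence n = begin
      powerSum α β γ (3 ℕ.+ n)
        ≈⟨ +-cong (+-cong (^-recurrence rootα n) (^-recurrence rootβ n)) (^-recurrence rootγ n) ⟩
      (α ^ (2 ℕ.+ n) + α ^ (1 ℕ.+ n) + α ^ n) + (β ^ (2 ℕ.+ n) + β ^ (1 ℕ.+ n) + β ^ n)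
        + (γ ^ (2 ℕ.+ n) + γ ^ (1 ℕ.+ n) + γ ^ n)
        ≈⟨ solve 9 (λ a₂ a₁ a₀ b₂ b₁ b₀ c₂ c₁ c₀ →
             (a₂ :+ a₁ :+ a₀) :+ (b₂ :+ b₁ :+ b₀) :+ (c₂ :+ c₁ :+ c₀)
               := (a₂ :+ b₂ :+ c₂) :+ (a₁ :+ b₁ :+ c₁) :+ (a₀ :+ b₀ :+ c₀)) refl
             (α ^ (2 ℕ.+ n)) (α ^ (1 ℕ.+ n)) (α ^ n) (β ^ (2 ℕ.+ n)) (β ^ (1 ℕ.+ n)) (β ^ n)
             (γ ^ (2 ℕ.+ n)) (γ ^ (1 ℕ.+ n)) (γ ^ n) ⟩
      powerSum α β γ (2 ℕ.+ n) + powerSum α β γ (1 ℕ.+ n) + powerSum α β γ n ∎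
      where
      rootα = α³≈α²+α+1 roots
      rootβ = α³≈α²+α+1 (RootsOfCubic-rotate roots)
      rootγ = α³≈α²+α+1 (RootsOfCubic-rotate (RootsOfCubic-rotate roots))

    ι∘S≈powerSum : ∀ n → ι (S n) ≈ powerSum α β γ n
    ι∘S≈powerSum 0 = solve 0 (ιₚ 3 := con 1 :+ con 1 :+ con 1) refl
    ι∘S≈powerSum 1 = begin
      ι 1              ≈⟨ +-identityʳ 1# ⟩
      1#               ≈⟨ e₁ ⟨
      σ₁ α β γ         ≈⟨ solve 3 (λ x y z → x :+ y :+ z := x :^ 1 :+ y :^ 1 :+ z :^ 1) refl α β γ ⟩
      powerSum α β γ 1 ∎
    ι∘S≈powerSum 2 = sym (begin
      powerSum α β γ 2                            ≈⟨ z≈0⇒x≈x+y*z _ (ι 2) (σ₂+1≈0 roots) ⟩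
      powerSum α β γ 2 + ι 2 * (σ₂ α β γ + 1#)    ≈⟨ solve 2 (λ p s → p :+ ιₚ 2 :* (s :+ con 1)
                                                             := p :+ ιₚ 2 :* s :+ ιₚ 2) refl _ (σ₂ α β γ) ⟩
      powerSum α β γ 2 + ι 2 * σ₂ α β γ + ι 2     ≈⟨ +-congʳ (newton₂ α β γ) ⟩
      σ₁ α β γ ^ 2 + ι 2                          ≈⟨ +-congʳ (^-congˡ 2 e₁) ⟩
      1# ^ 2 + ι 2                                ≈⟨ solve 0 (con 1 :^ 2 :+ ιₚ 2 := ιₚ 3) refl ⟩
      ι 3                                         ∎)
    ι∘S≈powerSum (suc (suc (suc n))) = begin
      ι (S (2 ℕ.+ n) ℕ.+ S (1 ℕ.+ n) ℕ.+ S n)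
        ≈⟨ ι-homo-+ (S (2 ℕ.+ n) ℕ.+ S (1 ℕ.+ n)) (S n) ⟩
      ι (S (2 ℕ.+ n) ℕ.+ S (1 ℕ.+ n)) + ι (S n)
        ≈⟨ +-congʳ (ι-homo-+ (S (2 ℕ.+ n)) (S (1 ℕ.+ n))) ⟩
      ι (S (2 ℕ.+ n)) + ι (S (1 ℕ.+ n)) + ι (S n)
        ≈⟨ +-cong (+-cong (ι∘S≈powerSum (suc (suc n))) (ι∘S≈powerSum (suc n))) (ι∘S≈powerSum n) ⟩
      powerSum α β γ (2 ℕ.+ n) + powerSum α β γ (1 ℕ.+ n) + powerSum α β γ n
        ≈⟨ powerSum-recurrence n ⟨
      powerSum α β γ (3 ℕ.+ n) ∎

    σ₃-of-powers≈1 : ∀ n → σ₃ (α ^ n) (β ^ n) (γ ^ n) ≈ 1#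
    σ₃-of-powers≈1 n = begin
      σ₃ (α ^ n) (β ^ n) (γ ^ n) ≈⟨ σ₃-^ α β γ n ⟩
      σ₃ α β γ ^ n               ≈⟨ ^-congˡ n e₃ ⟩
      1# ^ n                     ≈⟨ 1#^n≈1# n ⟩
      1#                         ∎

    module _ (n : ℕ) where
      private
        x = α ^ n
        y = β ^ n
        z = γ ^ n

        ι∘S-* : ∀ k → ι (S (k ℕ.* n)) ≈ powerSum x y z k
        ι∘S-* k = trans (ι∘S≈powerSum (k ℕ.* n)) (powerSum-* α β γ k n)

      S-fourth-power-with-C₂ₙ :
        ι (S n) ^ 4 ≈ ι (S (4 ℕ.* n)) + ι 2 * C α β γ (2 ℕ.* n) + ι 4 * (C α β γ n ^ 2)
                      + ι 4 * (ι (S (2 ℕ.* n)) * C α β γ n)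
      S-fourth-power-with-C₂ₙ = begin
        ι (S n) ^ 4
          ≈⟨ ^-congˡ 4 (ι∘S≈powerSum n) ⟩
        σ₁ x y z ^ 4
          ≈⟨ σ₁⁴-expansion x y z ⟩
        powerSum x y z 4 + ι 2 * σ₂ (x ^ 2) (y ^ 2) (z ^ 2) + ι 4 * σ₂ x y z ^ 2
          + ι 4 * (powerSum x y z 2 * σ₂ x y z)
          ≈⟨ +-cong (+-congʳ (+-cong (ι∘S-* 4) (*-congˡ (C-* α β γ 2 n))))
                    (*-congˡ (*-congʳ (ι∘S-* 2))) ⟨
        ι (S (4 ℕ.* n)) + ι 2 * C α β γ (2 ℕ.* n) + ι 4 * (C α β γ n ^ 2)
          + ι 4 * (ι (S (2 ℕ.* n)) * C α β γ n) ∎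

      S-fourth-power-with-Sₙ :
        ι (S n) ^ 4 ≈ ((ι (S (4 ℕ.* n)) - ι 4 * ι (S n)) + ι 4 * (ι (S (2 ℕ.* n)) * C α β γ n))
                      + ι 6 * (C α β γ n ^ 2)
      S-fourth-power-with-Sₙ = begin
        ι (S n) ^ 4
          ≈⟨ x+y≈z⇒x≈z-y expansion ⟩
        powerSum x y z 4 + ι 4 * (powerSum x y z 2 * σ₂ x y z) + ι 6 * σ₂ x y z ^ 2 - ι 4 * ι (S n)
          ≈⟨ x+y+z-w≈x-w+y+z _ _ _ _ ⟩
        powerSum x y z 4 - ι 4 * ι (S n) + ι 4 * (powerSum x y z 2 * σ₂ x y z) + ι 6 * σ₂ x y z ^ 2
          ≈⟨ +-congʳ (+-cong (+-congʳ (ι∘S-* 4)) (*-congˡ (*-congʳ (ι∘S-* 2)))) ⟨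
        ι (S (4 ℕ.* n)) - ι 4 * ι (S n) + ι 4 * (ι (S (2 ℕ.* n)) * C α β γ n) + ι 6 * (C α β γ n ^ 2) ∎
        where
        expansion : ι (S n) ^ 4 + ι 4 * ι (S n)
                    ≈ powerSum x y z 4 + ι 4 * (powerSum x y z 2 * σ₂ x y z) + ι 6 * σ₂ x y z ^ 2
        expansion = begin
          ι (S n) ^ 4 + ι 4 * ι (S n)
            ≈⟨ +-cong (^-congˡ 4 (ι∘S≈powerSum n)) (*-congˡ Sₙ≈σ₁σ₃) ⟩
          σ₁ x y z ^ 4 + ι 4 * (σ₁ x y z * σ₃ x y z)
            ≈⟨ σ₁⁴+4σ₁σ₃-expansion x y z ⟩
          powerSum x y z 4 + ι 4 * (powerSum x y z 2 * σ₂ x y z) + ι 6 * σ₂ x y z ^ 2 ∎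
          where
          Sₙ≈σ₁σ₃ : ι (S n) ≈ σ₁ x y z * σ₃ x y z
          Sₙ≈σ₁σ₃ = begin
            ι (S n)                 ≈⟨ ι∘S≈powerSum n ⟩
            σ₁ x y z                ≈⟨ *-identityʳ _ ⟨
            σ₁ x y z * 1#           ≈⟨ *-congˡ (σ₃-of-powers≈1 n) ⟨
            σ₁ x y z * σ₃ x y z     ∎

-- Imported only now: inside the development _*_ is the ring multiplication.
open import Data.Nat using (_*_)

mainTheorem10 : ∀ {c ℓ} (R : CommutativeRing c ℓ) (α β γ : CommutativeRing.Carrier R) →
  InRing.RootsOfCubic R α β γ →
  (n : ℕ) →
    let open CommutativeRing R hiding (_*_)
        open InRing R
        _·_ = CommutativeRing._*_ R
    in  (ι (S n) ^ 4 ≈ ι (S (4 * n)) + ι 2 · C α β γ (2 * n) + ι 4 · (C α β γ n ^ 2) + ι 4 · (ι (S (2 * n)) · C α β γ n))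
      × (ι (S n) ^ 4 ≈ ((ι (S (4 * n)) - ι 4 · ι (S n)) + ι 4 · (ι (S (2 * n)) · C α β γ n)) + ι 6 · (C α β γ n ^ 2))
mainTheorem10 R α β γ roots n = S-fourth-power-with-C₂ₙ R roots n , S-fourth-power-with-Sₙ R roots n
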